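{- For all $\alpha,\beta\in\mathcal{L}$: (i) $\vdash_{\mathbf{vD}}\alpha\longrightarrow(\sim\alpha\longrightarrow\beta)$; (ii) $\vdash_{\mathbf{vD}}\sim\alpha\lor\alpha$.
   Context: Let $V$ be a denumerable set of propositional variables and $\mathcal{L}$ the set of formulas generated from $V$ by the binary connectives $\land,\lor,\longrightarrow$ and the unary connectives $\neg,\circ$. Fix a formula $\beta_0$ and set $\bot:=\beta_0\land(\neg\beta_0\land\circ\beta_0)$; for every formula $\alpha$ let $\sim\alpha$ abbreviate $\alpha\longrightarrow\bot$. The logic $\mathbf{vD}=\langle\mathcal{L},\vdash_{\mathbf{vD}}\rangle$ has the following axiom schemas (for all $\alpha,\beta,\gamma\in\mathcal{L}$): (1) $\alpha\to(\beta\to\alpha)$; (2) $(\alpha\to(\beta\to\gamma))\to((\alpha\to\beta)\to(\alpha\to\gamma))$; (3) $\alpha\to(\beta\to(\alpha\land\beta))$; (4) $(\alpha\land\beta)\to\alpha$; (5) $(\alpha\land\beta)\to\beta$; (6) $\alpha\to(\alpha\lor\beta)$; (7) $\beta\to(\alpha\lor\beta)$; (8) $(\alpha\to\beta)\lor\alpha$; (9) $\alpha\lor\neg\alpha$; (10) $(\alpha\to\gamma)\to((\neg\alpha\to\gamma)\to((\alpha\lor\neg\alpha)\to\gamma))$; (11) $((\alpha\to\beta)\to\gamma)\to((\alpha\to\gamma)\to(((\alpha\to\beta)\lor\alpha)\to\gamma))$; (12) $\circ\alpha\to(\alpha\to(\neg\alpha\to\beta))$; (13) $\circ\alpha\lor(\alpha\land\neg\alpha)$;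 (14) $(\circ\alpha\to\gamma)\to(((\alpha\land\neg\alpha)\to\gamma)\to((\circ\alpha\lor(\alpha\land\neg\alpha))\to\gamma))$; (15) $\sim\neg\alpha\to\sim\neg\sim\neg\alpha$; (16) $\sim\neg\sim\neg\alpha\to\sim\neg\alpha$; (17) $\sim\neg(\alpha\land\beta)\to(\sim\neg\alpha\land\sim\neg\beta)$; (18) $(\sim\neg\alpha\land\sim\neg\beta)\to\sim\neg(\alpha\land\beta)$ (here $\to$ denotes $\longrightarrow$). Rules: (MP) from $\alpha$ and $\alpha\longrightarrow\beta$ infer $\beta$; (N) from $\alpha$ infer $\neg\alpha\longrightarrow\sim\alpha$, applicable only when $\alpha$ is a theorem. A derivation of $\varphi$ from $\Gamma$ is a finite sequence $\varphi_1,\dots,\varphi_n=\varphi$ where each $\varphi_i$ is an axiom instance, or belongs to $\Gamma$, or follows by MP from earlier members, or is obtained by (N) from an earlier $\varphi_j$ which is a theorem. $\Gamma\vdash_{\mathbf{vD}}\varphi$ means such a derivation exists; $\varphi$ is a theorem if $\emptyset\vdash_{\mathbf{vD}}\varphi$. -}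

module Defs where

open import Data.Nat using (ℕ)

data Form : Set where
  var  : ℕ → Form
  _∧_  : Form → Form → Form
  _∨_  : Form → Form → Form
  _⇒_  : Form → Form → Form
  ¬'_  : Form → Form
  ∘_   : Form → Form

infixr 5 _⇒_
infixr 6 _∨_
infixr 7 _∧_
infix 8 ¬'_ ∘_

module vD (β₀ : Form) where

  ⊥' : Form
  ⊥' = β₀ ∧ (¬' β₀ ∧ ∘ β₀)

  ∼_ : Form → Form
  ∼ α = α ⇒ ⊥'
  infix 8 ∼_

  data Axiom : Form → Set where
    ax1  : ∀ α β → Axiom (α ⇒ (β ⇒ α))
    ax2  : ∀ α β γ → Axiom ((α ⇒ (β ⇒ γ)) ⇒ ((α ⇒ β) ⇒ (α ⇒ γ)))
    ax3  : ∀ α β → Axiom (α ⇒ (β ⇒ (α ∧ β)))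
    ax4  : ∀ α β → Axiom ((α ∧ β) ⇒ α)
    ax5  : ∀ α β → Axiom ((α ∧ β) ⇒ β)
    ax6  : ∀ α β → Axiom (α ⇒ (α ∨ β))
    ax7  : ∀ α β → Axiom (β ⇒ (α ∨ β))
    ax8  : ∀ α β → Axiom ((α ⇒ β) ∨ α)
    ax9  : ∀ α → Axiom (α ∨ ¬' α)
    ax10 : ∀ α γ → Axiom ((α ⇒ γ) ⇒ ((¬' α ⇒ γ) ⇒ ((α ∨ ¬' α) ⇒ γ)))
    ax11 : ∀ α β γ → Axiom (((α ⇒ β) ⇒ γ) ⇒ ((α ⇒ γ) ⇒ (((α ⇒ β) ∨ α) ⇒ γ)))
    ax12 : ∀ α β → Axiom (∘ α ⇒ (α ⇒ (¬' α ⇒ β)))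
    ax13 : ∀ α → Axiom (∘ α ∨ (α ∧ ¬' α))
    ax14 : ∀ α γ → Axiom ((∘ α ⇒ γ) ⇒ (((α ∧ ¬' α) ⇒ γ) ⇒ ((∘ α ∨ (α ∧ ¬' α)) ⇒ γ)))
    ax15 : ∀ α → Axiom (∼ ¬' α ⇒ ∼ ¬' ∼ ¬' α)
    ax16 : ∀ α → Axiom (∼ ¬' ∼ ¬' α ⇒ ∼ ¬' α)
    ax17 : ∀ α β → Axiom (∼ ¬' (α ∧ β) ⇒ (∼ ¬' α ∧ ∼ ¬' β))
    ax18 : ∀ α β → Axiom ((∼ ¬' α ∧ ∼ ¬' β) ⇒ ∼ ¬' (α ∧ β))

  data Thm : Form → Set where
    axm : ∀ {φ} → Axiom φ → Thm φ
    mp  : ∀ {α β} → Thm α → Thm (α ⇒ β) → Thm β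
    nec : ∀ {α} → Thm α → Thm (¬' α ⇒ ∼ α)

  data _⊢_ (Γ : Form → Set) : Form → Set where
    axm : ∀ {φ} → Axiom φ → Γ ⊢ φ
    hyp : ∀ {φ} → Γ φ → Γ ⊢ φ
    mp  : ∀ {α β} → Γ ⊢ α → Γ ⊢ (α ⇒ β) → Γ ⊢ β
    nec : ∀ {α} → Thm α → Γ ⊢ (¬' α ⇒ ∼ α)
  infix 4 _⊢_

  ∅ : Form → Set
  ∅ _ = ⊥
    where open import Data.Empty using (⊥)

{-# OPTIONS --safe #-}
module Submission where

open import Defs
open import Data.Product using (_×_; _,_)

-- (i) is internal modus ponens followed by explosion from ⊥', which is an
-- instance of axiom (12) because ⊥' conjoins β₀, ¬' β₀ and ∘ β₀.
-- (ii) is the instance β := ⊥' of axiom (8).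

module _ (β₀ : Form) {Γ : Form → Set} where
  open vD β₀

  ⇒-weaken : ∀ {φ ψ} → Γ ⊢ φ → Γ ⊢ ψ ⇒ φ
  ⇒-weaken {φ} {ψ} ⊢φ = mp ⊢φ (axm (ax1 φ ψ))

  mp⇒ : ∀ {φ ψ χ} → Γ ⊢ φ ⇒ (ψ ⇒ χ) → Γ ⊢ φ ⇒ ψ → Γ ⊢ φ ⇒ χ
  mp⇒ {φ} {ψ} {χ} ⊢φψχ ⊢φψ = mp ⊢φψ (mp ⊢φψχ (axm (ax2 φ ψ χ)))

  mp⇒⇒ : ∀ {φ ψ χ θ} →
         Γ ⊢ φ ⇒ (ψ ⇒ (χ ⇒ θ)) → Γ ⊢ φ ⇒ (ψ ⇒ χ) → Γ ⊢ φ ⇒ (ψ ⇒ θ)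
  mp⇒⇒ {ψ = ψ} {χ} {θ} ⊢φψχθ ⊢φψχ =
    mp⇒ (mp⇒ (⇒-weaken (axm (ax2 ψ χ θ))) ⊢φψχθ) ⊢φψχ

  ⇒-refl : ∀ {φ} → Γ ⊢ φ ⇒ φ
  ⇒-refl {φ} = mp⇒ (axm (ax1 φ (φ ⇒ φ))) (axm (ax1 φ φ))

  ⇒-trans : ∀ {φ ψ χ} → Γ ⊢ φ ⇒ ψ → Γ ⊢ ψ ⇒ χ → Γ ⊢ φ ⇒ χ
  ⇒-trans ⊢φψ ⊢ψχ = mp⇒ (⇒-weaken ⊢ψχ) ⊢φψ

  ⇒-app : ∀ {φ ψ} → Γ ⊢ φ ⇒ ((φ ⇒ ψ) ⇒ ψ)
  ⇒-app {φ} {ψ} = mp⇒⇒ (⇒-weaken ⇒-refl) (axm (ax1 φ (φ ⇒ ψ)))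

  ⊥'-elim : ∀ φ → Γ ⊢ ⊥' ⇒ φ
  ⊥'-elim φ = mp⇒ (mp⇒ (mp⇒ (⇒-weaken (axm (ax12 β₀ φ))) ⊢∘β₀) ⊢β₀) ⊢¬β₀
    where
    ⊢β₀ : Γ ⊢ ⊥' ⇒ β₀
    ⊢β₀ = axm (ax4 _ _)

    ⊢¬β₀ : Γ ⊢ ⊥' ⇒ ¬' β₀
    ⊢¬β₀ = ⇒-trans (axm (ax5 _ _)) (axm (ax4 _ _))

    ⊢∘β₀ : Γ ⊢ ⊥' ⇒ ∘ β₀
    ⊢∘β₀ = ⇒-trans (axm (ax5 _ _)) (axm (ax5 _ _))

  ∼-elim : ∀ α β → Γ ⊢ α ⇒ (∼ α ⇒ β)
  ∼-elim α β = mp⇒⇒ (⇒-weaken (⇒-weaken (⊥'-elim β))) ⇒-app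

  ∼-excluded-middle : ∀ α → Γ ⊢ ∼ α ∨ α
  ∼-excluded-middle α = axm (ax8 α ⊥')

theorem2p8 : (β₀ : Form) → let open vD β₀ in
    ∀ α β → (∅ ⊢ α ⇒ (∼ α ⇒ β)) × (∅ ⊢ ∼ α ∨ α)
theorem2p8 β₀ α β = ∼-elim β₀ α β , ∼-excluded-middle β₀ α
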